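{- For every integer $n\geqslant0$, let $$l=\lceil \log_{10}(n+2)\rceil,\qquad t_l=10^{l-1}-1,\qquad p_l=10^{l-1}\left(l-\frac{10}{9}\right)+l+\frac19,$$ $s_0=Smr(t_l)$, $s_1=Smr(t_l+1)$, $s_2=Smr(t_l+2)$, and $$\alpha_l=\frac{s_2-2\cdot10^l s_1+10^{2l}s_0}{(10^l-1)^2},\qquad \mu_l=\frac{10^{p_l}\left(10^{2l-1}-10^{l-1}-1\right)}{(10^l-1)^2},\qquad \theta_l=\frac{10^{p_l}}{10^l-1}.$$ Then $$Smr(n)=\alpha_l+\mu_l\,10^{l(n-t_l)}+\theta_l\,(n-t_l)\,10^{l(n-t_l)} .$$
   Context: For an integer $n\geqslant0$, the reverse Smarandache number $Smr(n)$ is the positive integer whose decimal representation is the concatenation of the decimal representations of $n+1,n,\ldots,2,1$ in this order (so $Smr(0)=1$, $Smr(1)=21$, $Smr(2)=321$). -}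

module Defs where

open import Data.Nat using (ℕ; zero; suc; _+_; _*_; _∸_; _^_; _<_; _≤_; _<ᵇ_; _/_; NonZero; >-nonZero; s≤s; z≤n)
open import Data.Nat.Properties using (m^n≢0; m<n⇒0<n∸m; ≤-trans; m≤m*n; <-≤-trans)
open import Data.Bool using (if_then_else_)

-- Number of decimal digits of a natural number (decLen 0 = 1, as "0" has one digit).
-- decLenAux f m uses fuel f; with fuel m it is exact, since each step divides by 10.
decLenAux : ℕ → ℕ → ℕ
decLenAux zero    m = 1
decLenAux (suc f) m = if m <ᵇ 10 then 1 else suc (decLenAux f (m / 10))

decLen : ℕ → ℕ
decLen m = decLenAux m m

concatD : ℕ → ℕ → ℕ
concatD a b = a * 10 ^ decLen b + b

-- Reverse Smarandache number: concatenation of n+1, n, ..., 2, 1.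
Smr : ℕ → ℕ
Smr zero    = 1
Smr (suc n) = concatD (suc (suc n)) (Smr n)

den1-nonZero : ∀ k → NonZero (10 ^ suc k ∸ 1)
den1-nonZero k = >-nonZero (m<n⇒0<n∸m (<-≤-trans (s≤s (s≤s z≤n)) (m≤m*n 10 (10 ^ k))))
  where instance _ = m^n≢0 10 k

den2-nonZero : ∀ k → NonZero ((10 ^ suc k ∸ 1) ^ 2)
den2-nonZero k = m^n≢0 (10 ^ suc k ∸ 1) 2
  where instance _ = den1-nonZero k

module Submission where

open import Defs

-- Write len for decLen, so that Smr (j + 1) = (j + 2) · 10 ^ len (Smr j) + Smr j. Let t = 10^k − 1, l = k + 1,
-- X = 10^l and p = len (Smr t). While the appended numbers t + 2, t + 3, … all have l digits,
-- len (Smr (t + j)) = p + l j, so s_j = Smr (t + j) satisfies s_{j+1} = s_j + (c + j) 10^p X^j with c = t + 2: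
-- it is a partial sum of an arithmetico-geometric series. For such sums the quantity
--   (X − 1)² s_j − 10^p (c (X − 1) − X + (X − 1) j) X^j
-- does not depend on j, and evaluating it at j = 0 in terms of s_0, s_1, s_2 gives the claimed formula multiplied
-- by (X − 1)². Finally p is the paper's p_l, as counting digits block by block shows.

module DecimalLength where

  open import Data.Nat
  open import Data.Nat.Properties
  open import Data.Nat.DivMod using (m*n/n≡m; /-monoˡ-≤; m<n*o⇒m/o<n; m/n<m)
  open import Data.Nat.Tactic.RingSolver using (solve-∀)
  open import Data.Bool.Base using (true; false)
  open import Data.Product using (_,_; ∃-syntax)
  open import Data.Sum using (inj₁; inj₂)
  open import Function using (_∘_)
  open import Relation.Binary.PropositionalEquality
  open import Relation.Nullary using (contradiction; ofʸ; ofⁿ)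

  record FloorLog10 (y e : ℕ) : Set where
    constructor between
    field
      lower : 10 ^ e ≤ y
      upper : y < 10 ^ suc e

  floorLog10-10^ : ∀ e → FloorLog10 (10 ^ e) e
  floorLog10-10^ e = between ≤-refl (^-monoʳ-< 10 (s≤s (s≤s z≤n)) (n<1+n e))

  floorLog10-exists : ∀ y → 0 < y → ∃[ e ] FloorLog10 y e
  floorLog10-exists (suc zero)    _ = 0 , between ≤-refl (s≤s (s≤s z≤n))
  floorLog10-exists (suc (suc y)) _ with floorLog10-exists (suc y) z<s
  ... | e , between 10^e≤1+y 1+y<10^1+e with m≤n⇒m<n∨m≡n 1+y<10^1+e
  ...   | inj₁ 2+y<10^1+e = e , between (m≤n⇒m≤1+n 10^e≤1+y) 2+y<10^1+e
  ...   | inj₂ 2+y≡10^1+e rewrite 2+y≡10^1+e = suc e , floorLog10-10^ (suc e)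

  floorLog10-/10 : ∀ {y e} → FloorLog10 y (suc e) → FloorLog10 (y / 10) e
  floorLog10-/10 {y} {e} (between lo hi) = between
    (subst (_≤ y / 10) (m*n/n≡m (10 ^ e) 10) (/-monoˡ-≤ 10 (subst (_≤ y) (*-comm 10 (10 ^ e)) lo)))
    (m<n*o⇒m/o<n (subst (y <_) (*-comm 10 (10 ^ suc e)) hi))

  decLenAux-exact : ∀ f {y e} → FloorLog10 y e → y ≤ f → decLenAux f y ≡ suc e
  decLenAux-exact zero {e = e} (between lo _) y≤0 =
    contradiction (≤-trans (m^n>0 10 e) (≤-trans lo y≤0)) λ ()
  decLenAux-exact (suc f) {y} {zero} (between _ y<10) _ with y <ᵇ 10 | <ᵇ-reflects-< y 10
  ... | true  | _        = refl
  ... | false | ofⁿ y≮10 = contradiction y<10 y≮10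
  decLenAux-exact (suc f) {y} {suc e} b@(between lo _) y≤1+f with y <ᵇ 10 | <ᵇ-reflects-< y 10
  ... | true  | ofʸ y<10 = contradiction (≤-trans (^-monoʳ-≤ 10 {1} {suc e} (s≤s z≤n)) lo) (<⇒≱ y<10)
  ... | false | _        = cong suc (decLenAux-exact f (floorLog10-/10 b) y/10≤f)
    where
    instance _ = >-nonZero (≤-trans (m^n>0 10 (suc e)) lo)
    y/10≤f : y / 10 ≤ f
    y/10≤f = s≤s⁻¹ (<-≤-trans (m/n<m y 10 (s≤s (s≤s z≤n))) y≤1+f)

  decLen-exact : ∀ {y e} → FloorLog10 y e → decLen y ≡ suc e
  decLen-exact {y} b = decLenAux-exact y b ≤-refl

  floorLog10-concat : ∀ {a b e₁ e₂} → FloorLog10 a e₁ → FloorLog10 b e₂ →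
                      FloorLog10 (a * 10 ^ suc e₂ + b) (e₁ + suc e₂)
  floorLog10-concat {a} {b} {e₁} {e₂} (between lo₁ hi₁) (between _ hi₂) = between lo hi
    where
    open ≤-Reasoning
    P = 10 ^ suc e₂
    lo : 10 ^ (e₁ + suc e₂) ≤ a * P + b
    lo = begin
      10 ^ (e₁ + suc e₂) ≡⟨ ^-distribˡ-+-* 10 e₁ (suc e₂) ⟩
      10 ^ e₁ * P        ≤⟨ *-monoˡ-≤ P lo₁ ⟩
      a * P              ≤⟨ m≤m+n (a * P) b ⟩
      a * P + b          ∎
    hi : a * P + b < 10 ^ suc (e₁ + suc e₂)
    hi = begin-strict
      a * P + b          <⟨ +-monoʳ-< (a * P) hi₂ ⟩
      a * P + P          ≡⟨ +-comm (a * P) P ⟩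
      suc a * P          ≤⟨ *-monoˡ-≤ P hi₁ ⟩
      10 ^ suc e₁ * P    ≡⟨ ^-distribˡ-+-* 10 (suc e₁) (suc e₂) ⟨
      10 ^ (suc e₁ + suc e₂) ∎

  decLen-concatD : ∀ {a b} → 0 < a → 0 < b → decLen (concatD a b) ≡ decLen a + decLen b
  decLen-concatD {a} {b} 0<a 0<b with floorLog10-exists a 0<a | floorLog10-exists b 0<b
  ... | e₁ , a-digits | e₂ , b-digits = begin
    decLen (a * 10 ^ decLen b + b) ≡⟨ cong (λ d → decLen (a * 10 ^ d + b)) (decLen-exact b-digits) ⟩
    decLen (a * 10 ^ suc e₂ + b)   ≡⟨ decLen-exact (floorLog10-concat a-digits b-digits) ⟩
    suc e₁ + suc e₂                ≡⟨ cong₂ _+_ (decLen-exact a-digits) (decLen-exact b-digits) ⟨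
    decLen a + decLen b            ∎
    where open ≡-Reasoning

  Smr-pos : ∀ n → 0 < Smr n
  Smr-pos zero    = z<s
  Smr-pos (suc n) = <-≤-trans (Smr-pos n) (m≤n+m (Smr n) _)

  decLen-Smr-suc : ∀ n → decLen (Smr (suc n)) ≡ decLen (suc (suc n)) + decLen (Smr n)
  decLen-Smr-suc n = decLen-concatD {suc (suc n)} z<s (Smr-pos n)

  decLen-10^ : ∀ e → decLen (10 ^ e) ≡ suc e
  decLen-10^ e = decLen-exact (floorLog10-10^ e)

  -- Appending the j numbers t+2, …, t+j+1, each with suc k digits.
  decLen-Smr-+ : ∀ {k t} j → 10 ^ k ≤ suc (suc t) → suc t + j < 10 ^ suc k →
                 decLen (Smr (t + j)) ≡ decLen (Smr t) + suc k * j
  decLen-Smr-+ {k} {t} zero _ _ =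
    trans (cong (decLen ∘ Smr) (+-identityʳ t))
          (sym (trans (cong (decLen (Smr t) +_) (*-zeroʳ (suc k))) (+-identityʳ _)))
  decLen-Smr-+ {k} {t} (suc j) lo hi = begin
    decLen (Smr (t + suc j))                          ≡⟨ cong (decLen ∘ Smr) (+-suc t j) ⟩
    decLen (Smr (suc (t + j)))                        ≡⟨ decLen-Smr-suc (t + j) ⟩
    decLen (suc (suc (t + j))) + decLen (Smr (t + j)) ≡⟨ cong₂ _+_ (decLen-exact next-digits) (decLen-Smr-+ {k} j lo hi′) ⟩
    suc k + (decLen (Smr t) + suc k * j)              ≡⟨ regroup (suc k) (decLen (Smr t)) j ⟩
    decLen (Smr t) + suc k * suc j                    ∎
    where
    open ≡-Reasoning
    regroup : ∀ a b j → a + (b + a * j) ≡ b + a * suc j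
    regroup = solve-∀
    next-digits : FloorLog10 (suc (suc (t + j))) k
    next-digits = between (≤-trans lo (s≤s (s≤s (m≤m+n t j)))) (subst (_< 10 ^ suc k) (cong suc (+-suc t j)) hi)
    hi′ : suc t + j < 10 ^ suc k
    hi′ = <-trans (+-monoʳ-< (suc t) (n<1+n j)) hi

  suc-10^∸1 : ∀ k → suc (10 ^ k ∸ 1) ≡ 10 ^ k
  suc-10^∸1 k = suc-pred (10 ^ k) {{m^n≢0 10 k}}

  -- Smr (10^(k+1) − 1) is Smr (10^k − 1) followed by 9·10^k − 1 numbers of k+1 digits and by 10^(k+1).
  decLen-Smr-10^suc∸1 : ∀ k → let t = 10 ^ k ∸ 1 in
    decLen (Smr (10 ^ suc k ∸ 1)) ≡ suc (suc k) + (decLen (Smr t) + suc k * (9 * t + 8))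
  decLen-Smr-10^suc∸1 k = begin
    decLen (Smr (10 ^ suc k ∸ 1))                   ≡⟨ cong (decLen ∘ Smr) 10^suc∸1≡ ⟩
    decLen (Smr (suc (t + m)))                      ≡⟨ decLen-Smr-suc (t + m) ⟩
    decLen (suc (suc (t + m))) + decLen (Smr (t + m)) ≡⟨ cong₂ _+_ last-digits (decLen-Smr-+ {k} m lo hi) ⟩
    suc (suc k) + (decLen (Smr t) + suc k * m)      ∎
    where
    open ≡-Reasoning
    t = 10 ^ k ∸ 1
    m = 9 * t + 8
    10^suc∸1≡ : 10 ^ suc k ∸ 1 ≡ suc (t + m)
    10^suc∸1≡ = trans (cong (λ T → 10 * T ∸ 1) (sym (suc-10^∸1 k))) (shift t)
      where
      shift : ∀ t → t + 9 * suc t ≡ suc (t + (9 * t + 8))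
      shift = solve-∀
    10^suc≡ : 10 ^ suc k ≡ suc (suc (t + m))
    10^suc≡ = trans (sym (suc-10^∸1 (suc k))) (cong suc 10^suc∸1≡)
    last-digits : decLen (suc (suc (t + m))) ≡ suc (suc k)
    last-digits = trans (cong decLen (sym 10^suc≡)) (decLen-10^ (suc k))
    lo : 10 ^ k ≤ suc (suc t)
    lo = ≤-trans (≤-reflexive (sym (suc-10^∸1 k))) (n≤1+n _)
    hi : suc t + m < 10 ^ suc k
    hi = subst (suc (t + m) <_) (sym 10^suc≡) (n<1+n _)

  -- The paper's p_l, multiplied by 9.
  decLen-Smr-10^∸1 : ∀ k → 9 * decLen (Smr (10 ^ k ∸ 1)) + 10 * 10 ^ k ≡ 9 * suc k * 10 ^ k + 9 * suc k + 1
  decLen-Smr-10^∸1 zero    = refl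
  decLen-Smr-10^∸1 (suc k) =
    step {L = decLen (Smr (10 ^ k ∸ 1))} (suc-10^∸1 k) (decLen-Smr-10^suc∸1 k) (decLen-Smr-10^∸1 k)
    where
    step : ∀ {t T L L′} → suc t ≡ T → L′ ≡ suc (suc k) + (L + suc k * (9 * t + 8)) →
           9 * L + 10 * T ≡ 9 * suc k * T + 9 * suc k + 1 →
           9 * L′ + 10 * (10 * T) ≡ 9 * suc (suc k) * (10 * T) + 9 * suc (suc k) + 1
    step {t} {L = L} refl refl ih = +-cancelʳ-≡ (10 * suc t) _ _ (begin
      9 * (suc (suc k) + (L + suc k * (9 * t + 8))) + 10 * (10 * suc t) + 10 * suc t
        ≡⟨ split k t L ⟩
      (9 * L + 10 * suc t) + (9 * suc (suc k) + 9 * suc k * (9 * t + 8) + 100 * suc t)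
        ≡⟨ cong (_+ (9 * suc (suc k) + 9 * suc k * (9 * t + 8) + 100 * suc t)) ih ⟩
      (9 * suc k * suc t + 9 * suc k + 1) + (9 * suc (suc k) + 9 * suc k * (9 * t + 8) + 100 * suc t)
        ≡⟨ merge k t ⟩
      9 * suc (suc k) * (10 * suc t) + 9 * suc (suc k) + 1 + 10 * suc t ∎)
      where
      open ≡-Reasoning
      split : ∀ k t L → 9 * (suc (suc k) + (L + suc k * (9 * t + 8))) + 10 * (10 * suc t) + 10 * suc t
                      ≡ (9 * L + 10 * suc t) + (9 * suc (suc k) + 9 * suc k * (9 * t + 8) + 100 * suc t)
      split = solve-∀
      merge : ∀ k t → (9 * suc k * suc t + 9 * suc k + 1) + (9 * suc (suc k) + 9 * suc k * (9 * t + 8) + 100 * suc t)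
                      ≡ 9 * suc (suc k) * (10 * suc t) + 9 * suc (suc k) + 1 + 10 * suc t
      merge = solve-∀

module ArithmeticoGeometric where

  open import Data.Nat using (ℕ; zero; suc; _<_; _≤_; z<s)
  open import Data.Nat.Properties using (<-trans; <⇒≤)
  open import Data.Integer using (ℤ; +_; _+_; _*_; _-_; _^_)
  open import Data.Integer.Tactic.RingSolver using (solve-∀)
  open import Relation.Binary.PropositionalEquality
  open ≡-Reasoning

  module _ (X A c : ℤ) (s : ℕ → ℤ) where

    invariant : ℕ → ℤ
    invariant m = (X - + 1) * (X - + 1) * s m - A * (c * (X - + 1) - X + (X - + 1) * + m) * X ^ m

    invariant-suc : ∀ j → s (suc j) ≡ (c + + j) * A * X ^ j + s j → invariant (suc j) ≡ invariant j
    invariant-suc j s-suc = trans (cong (λ v → (X - + 1) * (X - + 1) * v - _) s-suc) (identity X A c (+ j) (X ^ j) (s j))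
      where
      identity : ∀ X A c j Y S →
        (X - + 1) * (X - + 1) * ((c + j) * A * Y + S) - A * (c * (X - + 1) - X + (X - + 1) * (+ 1 + j)) * (X * Y)
          ≡ (X - + 1) * (X - + 1) * S - A * (c * (X - + 1) - X + (X - + 1) * j) * Y
      identity = solve-∀

    module _ {M : ℕ} (s-suc : ∀ j → j < M → s (suc j) ≡ (c + + j) * A * X ^ j + s j) where

      invariant-constant : ∀ m → m ≤ M → invariant m ≡ invariant 0
      invariant-constant zero    _   = refl
      invariant-constant (suc m) m<M = trans (invariant-suc m (s-suc m m<M)) (invariant-constant m (<⇒≤ m<M))

      invariant-zero : 2 ≤ M → s 2 - + 2 * X * s 1 + X * X * s 0 ≡ invariant 0
      invariant-zero 2≤M = begin
        s 2 - + 2 * X * s 1 + X * X * s 0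
          ≡⟨ cong (λ v → v - + 2 * X * s 1 + X * X * s 0) (s-suc 1 2≤M) ⟩
        (c + + 1) * A * (X * + 1) + s 1 - + 2 * X * s 1 + X * X * s 0
          ≡⟨ cong (λ v → (c + + 1) * A * (X * + 1) + v - + 2 * X * v + X * X * s 0) (s-suc 0 (<-trans z<s 2≤M)) ⟩
        (c + + 1) * A * (X * + 1) + ((c + + 0) * A * + 1 + s 0) - + 2 * X * ((c + + 0) * A * + 1 + s 0) + X * X * s 0
          ≡⟨ identity X A c (s 0) ⟩
        invariant 0 ∎
        where
        identity : ∀ X A c S →
          (c + + 1) * A * (X * + 1) + ((c + + 0) * A * + 1 + S) - + 2 * X * ((c + + 0) * A * + 1 + S) + X * X * S
            ≡ (X - + 1) * (X - + 1) * S - A * (c * (X - + 1) - X + (X - + 1) * + 0) * + 1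
        identity = solve-∀

      closed-form : 2 ≤ M → ∀ m → m ≤ M →
        (X - + 1) * (X - + 1) * s m
          ≡ (s 2 - + 2 * X * s 1 + X * X * s 0) + A * (c * (X - + 1) - X) * X ^ m + A * (X - + 1) * + m * X ^ m
      closed-form 2≤M m m≤M = begin
        (X - + 1) * (X - + 1) * s m
          ≡⟨ identity X A c (+ m) (X ^ m) (s m) ⟩
        invariant m + A * (c * (X - + 1) - X) * X ^ m + A * (X - + 1) * + m * X ^ m
          ≡⟨ cong (λ C → C + A * (c * (X - + 1) - X) * X ^ m + A * (X - + 1) * + m * X ^ m)
                  (trans (invariant-constant m m≤M) (sym (invariant-zero 2≤M))) ⟩
        (s 2 - + 2 * X * s 1 + X * X * s 0) + A * (c * (X - + 1) - X) * X ^ m + A * (X - + 1) * + m * X ^ m ∎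
        where
        identity : ∀ X A c m Y S →
          (X - + 1) * (X - + 1) * S
            ≡ ((X - + 1) * (X - + 1) * S - A * (c * (X - + 1) - X + (X - + 1) * m) * Y) + A * (c * (X - + 1) - X) * Y + A * (X - + 1) * m * Y
        identity = solve-∀

open DecimalLength
open ArithmeticoGeometric

open import Data.Nat as ℕ using (ℕ; zero; suc; _^_; _∸_; _<_; _≤_; s≤s; z≤n; NonZero)
import Data.Nat.Properties as ℕ
open import Data.Integer as ℤ using (ℤ; +_)
import Data.Integer.Properties as ℤ
import Data.Integer.Tactic.RingSolver as ℤ-Solver
open import Data.Rational as ℚ using (ℚ; _/_; 1ℚ; toℚᵘ)
import Data.Rational.Properties as ℚ
open import Data.Rational.Unnormalised as ℚᵘ using (mkℚᵘ; *≡*)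
import Data.Rational.Unnormalised.Properties as ℚᵘ
open import Data.Rational.Solver using (module +-*-Solver)
open import Function using (_∘_)
open import Relation.Binary.PropositionalEquality

fromℤ : ℤ → ℚ
fromℤ i = i / 1

toℚᵘ-/ : ∀ i d → toℚᵘ (i / suc d) ℚᵘ.≃ mkℚᵘ i d
toℚᵘ-/ i d = ℚ.toℚᵘ-fromℚᵘ (mkℚᵘ i d)

fromℤ-+ : ∀ i j → fromℤ (i ℤ.+ j) ≡ fromℤ i ℚ.+ fromℤ j
fromℤ-+ i j = ℚ.toℚᵘ-injective (begin-equality
  toℚᵘ (fromℤ (i ℤ.+ j))                ≃⟨ toℚᵘ-/ (i ℤ.+ j) 0 ⟩
  mkℚᵘ (i ℤ.+ j) 0                       ≃⟨ *≡* (identity i j) ⟩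
  mkℚᵘ i 0 ℚᵘ.+ mkℚᵘ j 0                ≃⟨ ℚᵘ.+-cong (toℚᵘ-/ i 0) (toℚᵘ-/ j 0) ⟨
  toℚᵘ (fromℤ i) ℚᵘ.+ toℚᵘ (fromℤ j)    ≃⟨ ℚ.toℚᵘ-homo-+ (fromℤ i) (fromℤ j) ⟨
  toℚᵘ (fromℤ i ℚ.+ fromℤ j)            ∎)
  where
  open ℚᵘ.≤-Reasoning
  identity : ∀ i j → (i ℤ.+ j) ℤ.* + 1 ≡ (i ℤ.* + 1 ℤ.+ j ℤ.* + 1) ℤ.* + 1
  identity = ℤ-Solver.solve-∀

fromℤ-* : ∀ i j → fromℤ (i ℤ.* j) ≡ fromℤ i ℚ.* fromℤ j
fromℤ-* i j = ℚ.toℚᵘ-injective (begin-equality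
  toℚᵘ (fromℤ (i ℤ.* j))                ≃⟨ toℚᵘ-/ (i ℤ.* j) 0 ⟩
  mkℚᵘ (i ℤ.* j) 0                       ≃⟨ ℚᵘ.*-cong (toℚᵘ-/ i 0) (toℚᵘ-/ j 0) ⟨
  toℚᵘ (fromℤ i) ℚᵘ.* toℚᵘ (fromℤ j)    ≃⟨ ℚ.toℚᵘ-homo-* (fromℤ i) (fromℤ j) ⟨
  toℚᵘ (fromℤ i ℚ.* fromℤ j)            ∎)
  where open ℚᵘ.≤-Reasoning

fromℤ-injective : ∀ {i j} → fromℤ i ≡ fromℤ j → i ≡ j
fromℤ-injective {i} {j} eq with ℚᵘ.≃-trans (ℚᵘ.≃-sym (toℚᵘ-/ i 0)) (ℚᵘ.≃-trans (ℚ.toℚᵘ-cong eq) (toℚᵘ-/ j 0))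
... | *≡* i*1≡j*1 = trans (sym (ℤ.*-identityʳ i)) (trans i*1≡j*1 (ℤ.*-identityʳ j))

/-*-fromℤ : ∀ i d .{{_ : NonZero d}} → (i / d) ℚ.* fromℤ (+ d) ≡ fromℤ i
/-*-fromℤ i (suc d) = ℚ.toℚᵘ-injective (begin-equality
  toℚᵘ ((i / suc d) ℚ.* fromℤ (+ suc d))   ≃⟨ ℚ.toℚᵘ-homo-* (i / suc d) (fromℤ (+ suc d)) ⟩
  toℚᵘ (i / suc d) ℚᵘ.* toℚᵘ (fromℤ (+ suc d)) ≃⟨ ℚᵘ.*-cong (toℚᵘ-/ i d) (toℚᵘ-/ (+ suc d) 0) ⟩
  mkℚᵘ i d ℚᵘ.* mkℚᵘ (+ suc d) 0            ≃⟨ *≡* cancel ⟩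
  mkℚᵘ i 0                                 ≃⟨ toℚᵘ-/ i 0 ⟨
  toℚᵘ (fromℤ i)                           ∎)
  where
  open ℚᵘ.≤-Reasoning
  cancel : (i ℤ.* + suc d) ℤ.* + 1 ≡ i ℤ.* + suc (d ℕ.* 1)
  cancel = trans (ℤ.*-identityʳ _) (cong (λ e → i ℤ.* + suc e) (sym (ℕ.*-identityʳ d)))

module QS = +-*-Solver

*-cancelʳ-invertible : ∀ {x y w} u → u ℚ.* w ≡ 1ℚ → x ℚ.* w ≡ y ℚ.* w → x ≡ y
*-cancelʳ-invertible {x} {y} {w} u u*w≡1 x*w≡y*w = begin
  x                 ≡⟨ ℚ.*-identityʳ x ⟨
  x ℚ.* 1ℚ          ≡⟨ cong (x ℚ.*_) u*w≡1 ⟨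
  x ℚ.* (u ℚ.* w)   ≡⟨ reassoc x u w ⟩
  (x ℚ.* w) ℚ.* u   ≡⟨ cong (ℚ._* u) x*w≡y*w ⟩
  (y ℚ.* w) ℚ.* u   ≡⟨ reassoc y u w ⟨
  y ℚ.* (u ℚ.* w)   ≡⟨ cong (y ℚ.*_) u*w≡1 ⟩
  y ℚ.* 1ℚ          ≡⟨ ℚ.*-identityʳ y ⟩
  y                 ∎
  where
  open ≡-Reasoning
  reassoc : ∀ x u w → x ℚ.* (u ℚ.* w) ≡ (x ℚ.* w) ℚ.* u
  reassoc = QS.solve 3 (λ x u w → x QS.:* (u QS.:* w) QS.:= (x QS.:* w) QS.:* u) refl

/²-*-fromℤ² : ∀ i d .{{_ : NonZero d}} .{{_ : NonZero (d ℕ.^ 2)}} →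
              (i / d ℕ.^ 2) ℚ.* (fromℤ (+ d) ℚ.* fromℤ (+ d)) ≡ fromℤ i
/²-*-fromℤ² i d = trans (cong ((i / d ℕ.^ 2) ℚ.*_) (sym d²)) (/-*-fromℤ i (d ℕ.^ 2))
  where
  open ≡-Reasoning
  d² : fromℤ (+ (d ℕ.^ 2)) ≡ fromℤ (+ d) ℚ.* fromℤ (+ d)
  d² = begin
    fromℤ (+ (d ℕ.* (d ℕ.* 1))) ≡⟨ cong (λ e → fromℤ (+ (d ℕ.* e))) (ℕ.*-identityʳ d) ⟩
    fromℤ (+ (d ℕ.* d))         ≡⟨ cong fromℤ (ℤ.pos-* d d) ⟩
    fromℤ (+ d ℤ.* + d)         ≡⟨ fromℤ-* (+ d) (+ d) ⟩
    fromℤ (+ d) ℚ.* fromℤ (+ d) ∎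

clear-denominators : ∀ d .{{_ : NonZero d}} .{{_ : NonZero (d ℕ.^ 2)}} {S N a q Y M : ℤ} →
  + d ℤ.* + d ℤ.* S ≡ N ℤ.+ a ℤ.* q ℤ.* Y ℤ.+ a ℤ.* + d ℤ.* M ℤ.* Y →
  fromℤ S ≡ (N / d ℕ.^ 2) ℚ.+ (a ℤ.* q / d ℕ.^ 2) ℚ.* fromℤ Y ℚ.+ (a / d) ℚ.* fromℤ M ℚ.* fromℤ Y
clear-denominators d {S} {N} {a} {q} {Y} {M} eq =
  *-cancelʳ-invertible (+ 1 / d ℕ.^ 2) (/²-*-fromℤ² (+ 1) d) (begin
  fromℤ S ℚ.* (d′ ℚ.* d′)                                    ≡⟨ ℚ.*-comm (fromℤ S) (d′ ℚ.* d′) ⟩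
  d′ ℚ.* d′ ℚ.* fromℤ S                                       ≡⟨ cong (ℚ._* fromℤ S) (fromℤ-* (+ d) (+ d)) ⟨
  fromℤ (+ d ℤ.* + d) ℚ.* fromℤ S                             ≡⟨ fromℤ-* (+ d ℤ.* + d) S ⟨
  fromℤ (+ d ℤ.* + d ℤ.* S)                                   ≡⟨ cong fromℤ eq ⟩
  fromℤ (N ℤ.+ a ℤ.* q ℤ.* Y ℤ.+ a ℤ.* + d ℤ.* M ℤ.* Y)       ≡⟨ homs ⟩
  fromℤ N ℚ.+ fromℤ (a ℤ.* q) ℚ.* Y′ ℚ.+ fromℤ a ℚ.* d′ ℚ.* M′ ℚ.* Y′
    ≡⟨ cong₃ (/²-*-fromℤ² N d) (/²-*-fromℤ² (a ℤ.* q) d) (/-*-fromℤ a d) ⟨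
  q₁ ℚ.* (d′ ℚ.* d′) ℚ.+ q₂ ℚ.* (d′ ℚ.* d′) ℚ.* Y′ ℚ.+ q₃ ℚ.* d′ ℚ.* d′ ℚ.* M′ ℚ.* Y′
    ≡⟨ distrib q₁ q₂ q₃ d′ Y′ M′ ⟩
  (q₁ ℚ.+ q₂ ℚ.* Y′ ℚ.+ q₃ ℚ.* M′ ℚ.* Y′) ℚ.* (d′ ℚ.* d′)       ∎)
  where
  open ≡-Reasoning
  d′ = fromℤ (+ d)
  Y′ = fromℤ Y
  M′ = fromℤ M
  q₁ = N / d ℕ.^ 2
  q₂ = a ℤ.* q / d ℕ.^ 2
  q₃ = a / d
  cong₃ : ∀ {x x′ y y′ z z′} → x ≡ x′ → y ≡ y′ → z ≡ z′ →
          x ℚ.+ y ℚ.* Y′ ℚ.+ z ℚ.* d′ ℚ.* M′ ℚ.* Y′ ≡ x′ ℚ.+ y′ ℚ.* Y′ ℚ.+ z′ ℚ.* d′ ℚ.* M′ ℚ.* Y′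
  cong₃ refl refl refl = refl
  homs : fromℤ (N ℤ.+ a ℤ.* q ℤ.* Y ℤ.+ a ℤ.* + d ℤ.* M ℤ.* Y)
       ≡ fromℤ N ℚ.+ fromℤ (a ℤ.* q) ℚ.* Y′ ℚ.+ fromℤ a ℚ.* d′ ℚ.* M′ ℚ.* Y′
  homs = begin
    fromℤ (N ℤ.+ a ℤ.* q ℤ.* Y ℤ.+ a ℤ.* + d ℤ.* M ℤ.* Y)
      ≡⟨ fromℤ-+ (N ℤ.+ a ℤ.* q ℤ.* Y) (a ℤ.* + d ℤ.* M ℤ.* Y) ⟩
    fromℤ (N ℤ.+ a ℤ.* q ℤ.* Y) ℚ.+ fromℤ (a ℤ.* + d ℤ.* M ℤ.* Y)
      ≡⟨ cong₂ ℚ._+_ (fromℤ-+ N (a ℤ.* q ℤ.* Y)) (fromℤ-* (a ℤ.* + d ℤ.* M) Y) ⟩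
    fromℤ N ℚ.+ fromℤ (a ℤ.* q ℤ.* Y) ℚ.+ fromℤ (a ℤ.* + d ℤ.* M) ℚ.* Y′
      ≡⟨ cong₂ (λ u v → fromℤ N ℚ.+ u ℚ.+ v ℚ.* Y′) (fromℤ-* (a ℤ.* q) Y)
               (trans (fromℤ-* (a ℤ.* + d) M) (cong (ℚ._* M′) (fromℤ-* a (+ d)))) ⟩
    fromℤ N ℚ.+ fromℤ (a ℤ.* q) ℚ.* Y′ ℚ.+ fromℤ a ℚ.* d′ ℚ.* M′ ℚ.* Y′ ∎
  distrib : ∀ q₁ q₂ q₃ d Y M →
    q₁ ℚ.* (d ℚ.* d) ℚ.+ q₂ ℚ.* (d ℚ.* d) ℚ.* Y ℚ.+ q₃ ℚ.* d ℚ.* d ℚ.* M ℚ.* Y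
      ≡ (q₁ ℚ.+ q₂ ℚ.* Y ℚ.+ q₃ ℚ.* M ℚ.* Y) ℚ.* (d ℚ.* d)
  distrib = QS.solve 6 (λ q₁ q₂ q₃ d Y M →
    q₁ QS.:* (d QS.:* d) QS.:+ q₂ QS.:* (d QS.:* d) QS.:* Y QS.:+ q₃ QS.:* d QS.:* d QS.:* M QS.:* Y
      QS.:= (q₁ QS.:+ q₂ QS.:* Y QS.:+ q₃ QS.:* M QS.:* Y) QS.:* (d QS.:* d)) refl

fromℕ : ℕ → ℚ
fromℕ n = fromℤ (+ n)

fromℕ-+ : ∀ m n → fromℕ (m ℕ.+ n) ≡ fromℕ m ℚ.+ fromℕ n
fromℕ-+ m n = trans (cong fromℤ (ℤ.pos-+ m n)) (fromℤ-+ (+ m) (+ n))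

fromℕ-* : ∀ m n → fromℕ (m ℕ.* n) ≡ fromℕ m ℚ.* fromℕ n
fromℕ-* m n = trans (cong fromℤ (ℤ.pos-* m n)) (fromℤ-* (+ m) (+ n))

clear-ninths : ∀ p T l → fromℕ p ≡ fromℕ T ℚ.* (fromℕ l ℚ.- + 10 / 9) ℚ.+ fromℕ l ℚ.+ + 1 / 9 →
               9 ℕ.* p ℕ.+ 10 ℕ.* T ≡ 9 ℕ.* l ℕ.* T ℕ.+ 9 ℕ.* l ℕ.+ 1
clear-ninths p T l hp = ℤ.+-injective (fromℤ-injective (begin
  fromℕ (9 ℕ.* p ℕ.+ 10 ℕ.* T)
    ≡⟨ fromℕ-+ (9 ℕ.* p) (10 ℕ.* T) ⟩
  fromℕ (9 ℕ.* p) ℚ.+ fromℕ (10 ℕ.* T)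
    ≡⟨ cong₂ ℚ._+_ (fromℕ-* 9 p) (fromℕ-* 10 T) ⟩
  fromℕ 9 ℚ.* fromℕ p ℚ.+ fromℕ 10 ℚ.* fromℕ T
    ≡⟨ cong (λ x → fromℕ 9 ℚ.* x ℚ.+ fromℕ 10 ℚ.* fromℕ T) hp ⟩
  fromℕ 9 ℚ.* (fromℕ T ℚ.* (fromℕ l ℚ.- + 10 / 9) ℚ.+ fromℕ l ℚ.+ + 1 / 9) ℚ.+ fromℕ 10 ℚ.* fromℕ T
    ≡⟨ ninths (fromℕ T) (fromℕ l) ⟩
  fromℕ 9 ℚ.* fromℕ l ℚ.* fromℕ T ℚ.+ fromℕ 9 ℚ.* fromℕ l ℚ.+ fromℕ 1
    ≡⟨ cong (λ x → x ℚ.* fromℕ T ℚ.+ x ℚ.+ fromℕ 1) (fromℕ-* 9 l) ⟨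
  fromℕ (9 ℕ.* l) ℚ.* fromℕ T ℚ.+ fromℕ (9 ℕ.* l) ℚ.+ fromℕ 1
    ≡⟨ cong (λ x → x ℚ.+ fromℕ (9 ℕ.* l) ℚ.+ fromℕ 1) (fromℕ-* (9 ℕ.* l) T) ⟨
  fromℕ (9 ℕ.* l ℕ.* T) ℚ.+ fromℕ (9 ℕ.* l) ℚ.+ fromℕ 1
    ≡⟨ cong (ℚ._+ fromℕ 1) (fromℕ-+ (9 ℕ.* l ℕ.* T) (9 ℕ.* l)) ⟨
  fromℕ (9 ℕ.* l ℕ.* T ℕ.+ 9 ℕ.* l) ℚ.+ fromℕ 1
    ≡⟨ fromℕ-+ (9 ℕ.* l ℕ.* T ℕ.+ 9 ℕ.* l) 1 ⟨
  fromℕ (9 ℕ.* l ℕ.* T ℕ.+ 9 ℕ.* l ℕ.+ 1) ∎))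
  where
  open ≡-Reasoning
  ninths : ∀ T l → fromℕ 9 ℚ.* (T ℚ.* (l ℚ.- + 10 / 9) ℚ.+ l ℚ.+ + 1 / 9) ℚ.+ fromℕ 10 ℚ.* T
                   ≡ fromℕ 9 ℚ.* l ℚ.* T ℚ.+ fromℕ 9 ℚ.* l ℚ.+ fromℕ 1
  ninths = QS.solve 2 (λ T l →
    QS.con (fromℕ 9) QS.:* (T QS.:* (l QS.:- QS.con (+ 10 / 9)) QS.:+ l QS.:+ QS.con (+ 1 / 9)) QS.:+ QS.con (fromℕ 10) QS.:* T
      QS.:= QS.con (fromℕ 9) QS.:* l QS.:* T QS.:+ QS.con (fromℕ 9) QS.:* l QS.:+ QS.con (fromℕ 1)) refl

pos-^ : ∀ m n → + (m ^ n) ≡ (+ m) ℤ.^ n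
pos-^ m zero    = refl
pos-^ m (suc n) = trans (ℤ.pos-* m (m ^ n)) (cong (+ m ℤ.*_) (pos-^ m n))

pos-∸ : ∀ {m n} → n ≤ m → + (m ∸ n) ≡ + m ℤ.- + n
pos-∸ {m} {n} n≤m = sym (trans (ℤ.m-n≡m⊖n m n) (ℤ.⊖-≥ n≤m))

module TenPowerBlock (k : ℕ) where

  t : ℕ
  t = 10 ^ k ∸ 1

  X : ℤ
  X = + (10 ^ suc k)

  D : ℤ
  D = + (10 ^ suc k ∸ 1)

  s : ℕ → ℤ
  s j = + Smr (t ℕ.+ j)

  -- The numerators of the paper's α_l and of μ_l / 10^{p_l}.
  N Q : ℤ
  N = + Smr (t ℕ.+ 2) ℤ.- + 2 ℤ.* X ℤ.* + Smr (t ℕ.+ 1) ℤ.+ + (10 ^ (2 ℕ.* suc k)) ℤ.* + Smr t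
  Q = + (10 ^ (2 ℕ.* suc k ∸ 1)) ℤ.- + (10 ^ k) ℤ.- + 1

  s-suc : ∀ j → j < 9 ℕ.* 10 ^ k →
          s (suc j) ≡ (+ suc (suc t) ℤ.+ + j) ℤ.* + (10 ^ decLen (Smr t)) ℤ.* X ℤ.^ j ℤ.+ s j
  s-suc j j<9*10^k = begin
    + Smr (t ℕ.+ suc j)
      ≡⟨ cong (+_ ∘ Smr) (ℕ.+-suc t j) ⟩
    + (a ℕ.* 10 ^ decLen (Smr (t ℕ.+ j)) ℕ.+ Smr (t ℕ.+ j))
      ≡⟨ cong (λ e → + (a ℕ.* 10 ^ e ℕ.+ Smr (t ℕ.+ j))) (decLen-Smr-+ {k} j lo hi) ⟩
    + (a ℕ.* 10 ^ (L ℕ.+ suc k ℕ.* j) ℕ.+ Smr (t ℕ.+ j))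
      ≡⟨ cong (λ e → + (a ℕ.* e ℕ.+ Smr (t ℕ.+ j))) 10^[L+lj] ⟩
    + (a ℕ.* (10 ^ L ℕ.* (10 ^ suc k) ^ j) ℕ.+ Smr (t ℕ.+ j))
      ≡⟨ ℤ.pos-+ (a ℕ.* (10 ^ L ℕ.* (10 ^ suc k) ^ j)) (Smr (t ℕ.+ j)) ⟩
    + (a ℕ.* (10 ^ L ℕ.* (10 ^ suc k) ^ j)) ℤ.+ s j
      ≡⟨ cong (ℤ._+ s j) casts ⟩
    + a ℤ.* + (10 ^ L) ℤ.* X ℤ.^ j ℤ.+ s j ∎
    where
    open ≡-Reasoning
    a = suc (suc (t ℕ.+ j))
    L = decLen (Smr t)
    lo : 10 ^ k ≤ suc (suc t)
    lo = ℕ.≤-trans (ℕ.≤-reflexive (sym (suc-10^∸1 k))) (ℕ.n≤1+n _)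
    hi : suc t ℕ.+ j < 10 ^ suc k
    hi = subst (λ T → T ℕ.+ j < 10 ^ suc k) (sym (suc-10^∸1 k)) (ℕ.+-monoʳ-< (10 ^ k) j<9*10^k)
    10^[L+lj] : 10 ^ (L ℕ.+ suc k ℕ.* j) ≡ 10 ^ L ℕ.* (10 ^ suc k) ^ j
    10^[L+lj] = trans (ℕ.^-distribˡ-+-* 10 L (suc k ℕ.* j)) (cong (10 ^ L ℕ.*_) (sym (ℕ.^-*-assoc 10 (suc k) j)))
    casts : + (a ℕ.* (10 ^ L ℕ.* (10 ^ suc k) ^ j)) ≡ + a ℤ.* + (10 ^ L) ℤ.* X ℤ.^ j
    casts = begin
      + (a ℕ.* (10 ^ L ℕ.* (10 ^ suc k) ^ j))      ≡⟨ ℤ.pos-* a (10 ^ L ℕ.* (10 ^ suc k) ^ j) ⟩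
      + a ℤ.* + (10 ^ L ℕ.* (10 ^ suc k) ^ j)      ≡⟨ cong (+ a ℤ.*_) (ℤ.pos-* (10 ^ L) ((10 ^ suc k) ^ j)) ⟩
      + a ℤ.* (+ (10 ^ L) ℤ.* + ((10 ^ suc k) ^ j)) ≡⟨ cong (λ y → + a ℤ.* (+ (10 ^ L) ℤ.* y)) (pos-^ (10 ^ suc k) j) ⟩
      + a ℤ.* (+ (10 ^ L) ℤ.* X ℤ.^ j)              ≡⟨ ℤ.*-assoc (+ a) (+ (10 ^ L)) (X ℤ.^ j) ⟨
      + a ℤ.* + (10 ^ L) ℤ.* X ℤ.^ j                ∎

  module _ {n : ℕ} (lo : 10 ^ k < n ℕ.+ 2) (hi : n ℕ.+ 2 ≤ 10 ^ suc k) where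

    t≤n : t ≤ n
    t≤n = ℕ.+-cancelʳ-≤ 2 t n (ℕ.≤-trans (ℕ.≤-reflexive t+2≡) lo)
      where
      t+2≡ : t ℕ.+ 2 ≡ suc (10 ^ k)
      t+2≡ = trans (ℕ.+-comm t 2) (cong suc (suc-10^∸1 k))

    n∸t<9*10^k : n ∸ t < 9 ℕ.* 10 ^ k
    n∸t<9*10^k = ℕ.+-cancelˡ-< (suc t) (n ∸ t) (9 ℕ.* 10 ^ k) (begin-strict
      suc t ℕ.+ (n ∸ t)         ≡⟨ cong suc (ℕ.m+[n∸m]≡n t≤n) ⟩
      suc n                     ≡⟨ ℕ.+-comm 1 n ⟩
      n ℕ.+ 1                   <⟨ ℕ.+-monoʳ-< n (ℕ.n<1+n 1) ⟩
      n ℕ.+ 2                   ≤⟨ hi ⟩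
      10 ^ k ℕ.+ 9 ℕ.* 10 ^ k   ≡⟨ cong (ℕ._+ 9 ℕ.* 10 ^ k) (suc-10^∸1 k) ⟨
      suc t ℕ.+ 9 ℕ.* 10 ^ k    ∎)
      where open ℕ.≤-Reasoning

    Y : ℤ
    Y = + (10 ^ (suc k ℕ.* (n ∸ t)))

    Smr-closed-form-ℤ : ∀ {p} → decLen (Smr t) ≡ p →
      D ℤ.* D ℤ.* + Smr n ≡ N ℤ.+ + (10 ^ p) ℤ.* Q ℤ.* Y ℤ.+ + (10 ^ p) ℤ.* D ℤ.* (+ n ℤ.- + t) ℤ.* Y
    Smr-closed-form-ℤ refl = begin
      D ℤ.* D ℤ.* + Smr n
        ≡⟨ cong₂ (λ d x → d ℤ.* d ℤ.* x) D≡X-1 (cong (+_ ∘ Smr) (sym (ℕ.m+[n∸m]≡n t≤n))) ⟩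
      (X ℤ.- + 1) ℤ.* (X ℤ.- + 1) ℤ.* s m
        ≡⟨ closed-form X A c s s-suc 2≤9*10^k m (ℕ.<⇒≤ n∸t<9*10^k) ⟩
      (s 2 ℤ.- + 2 ℤ.* X ℤ.* s 1 ℤ.+ X ℤ.* X ℤ.* s 0) ℤ.+ A ℤ.* (c ℤ.* (X ℤ.- + 1) ℤ.- X) ℤ.* X ℤ.^ m
        ℤ.+ A ℤ.* (X ℤ.- + 1) ℤ.* + m ℤ.* X ℤ.^ m
        ≡⟨ cong₂ (λ C y → C ℤ.+ A ℤ.* (c ℤ.* (X ℤ.- + 1) ℤ.- X) ℤ.* y ℤ.+ A ℤ.* (X ℤ.- + 1) ℤ.* + m ℤ.* y) N≡ Y≡ ⟩
      N ℤ.+ A ℤ.* (c ℤ.* (X ℤ.- + 1) ℤ.- X) ℤ.* Y ℤ.+ A ℤ.* (X ℤ.- + 1) ℤ.* + m ℤ.* Y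
        ≡⟨ cong₂ (λ q x → N ℤ.+ A ℤ.* q ℤ.* Y ℤ.+ A ℤ.* (X ℤ.- + 1) ℤ.* x ℤ.* Y) Q≡ (pos-∸ t≤n) ⟩
      N ℤ.+ A ℤ.* Q ℤ.* Y ℤ.+ A ℤ.* (X ℤ.- + 1) ℤ.* (+ n ℤ.- + t) ℤ.* Y
        ≡⟨ cong (λ d → N ℤ.+ A ℤ.* Q ℤ.* Y ℤ.+ A ℤ.* d ℤ.* (+ n ℤ.- + t) ℤ.* Y) D≡X-1 ⟨
      N ℤ.+ A ℤ.* Q ℤ.* Y ℤ.+ A ℤ.* D ℤ.* (+ n ℤ.- + t) ℤ.* Y ∎
      where
      open ≡-Reasoning
      m = n ∸ t
      A = + (10 ^ decLen (Smr t))
      c = + suc (suc t)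
      T = + (10 ^ k)
      2≤9*10^k : 2 ≤ 9 ℕ.* 10 ^ k
      2≤9*10^k = ℕ.≤-trans (s≤s (s≤s z≤n)) (ℕ.*-monoʳ-≤ 9 (ℕ.m^n>0 10 k))
      D≡X-1 : D ≡ X ℤ.- + 1
      D≡X-1 = pos-∸ (ℕ.m^n>0 10 (suc k))
      10^-+ : ∀ a b → + (10 ^ (a ℕ.+ b)) ≡ + (10 ^ a) ℤ.* + (10 ^ b)
      10^-+ a b = trans (cong +_ (ℕ.^-distribˡ-+-* 10 a b)) (ℤ.pos-* (10 ^ a) (10 ^ b))
      N≡ : s 2 ℤ.- + 2 ℤ.* X ℤ.* s 1 ℤ.+ X ℤ.* X ℤ.* s 0 ≡ N
      N≡ = cong₂ (λ x y → s 2 ℤ.- + 2 ℤ.* X ℤ.* s 1 ℤ.+ x ℤ.* y)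
                 (sym (trans (cong (λ e → + (10 ^ (suc k ℕ.+ e))) (ℕ.+-identityʳ (suc k))) (10^-+ (suc k) (suc k))))
                 (cong (+_ ∘ Smr) (ℕ.+-identityʳ t))
      Y≡ : X ℤ.^ m ≡ Y
      Y≡ = trans (sym (pos-^ (10 ^ suc k) m)) (cong +_ (ℕ.^-*-assoc 10 (suc k) m))
      X≡ : X ≡ + 10 ℤ.* T
      X≡ = ℤ.pos-* 10 (10 ^ k)
      Q≡ : c ℤ.* (X ℤ.- + 1) ℤ.- X ≡ Q
      Q≡ = begin
        c ℤ.* (X ℤ.- + 1) ℤ.- X
          ≡⟨ cong₂ (λ c x → c ℤ.* (x ℤ.- + 1) ℤ.- x) (trans (cong (+_ ∘ suc) (suc-10^∸1 k)) (ℤ.pos-+ 1 (10 ^ k))) X≡ ⟩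
        (+ 1 ℤ.+ T) ℤ.* (+ 10 ℤ.* T ℤ.- + 1) ℤ.- + 10 ℤ.* T
          ≡⟨ identity T ⟩
        T ℤ.* (+ 10 ℤ.* T) ℤ.- T ℤ.- + 1
          ≡⟨ cong (λ x → T ℤ.* x ℤ.- T ℤ.- + 1) X≡ ⟨
        T ℤ.* X ℤ.- T ℤ.- + 1
          ≡⟨ cong (λ x → x ℤ.- T ℤ.- + 1) (trans (cong (λ e → + (10 ^ (k ℕ.+ e))) (ℕ.+-identityʳ (suc k))) (10^-+ k (suc k))) ⟨
        Q ∎
        where
        identity : ∀ T → (+ 1 ℤ.+ T) ℤ.* (+ 10 ℤ.* T ℤ.- + 1) ℤ.- + 10 ℤ.* T ≡ T ℤ.* (+ 10 ℤ.* T) ℤ.- T ℤ.- + 1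
        identity = ℤ-Solver.solve-∀

    Smr-closed-form : ∀ {p} → decLen (Smr t) ≡ p →
      fromℤ (+ Smr n) ≡ (N / (10 ^ suc k ∸ 1) ^ 2) {{den2-nonZero k}}
                        ℚ.+ (+ (10 ^ p) ℤ.* Q / (10 ^ suc k ∸ 1) ^ 2) {{den2-nonZero k}} ℚ.* fromℤ Y
                        ℚ.+ (+ (10 ^ p) / (10 ^ suc k ∸ 1)) {{den1-nonZero k}} ℚ.* fromℤ (+ n ℤ.- + t) ℚ.* fromℤ Y
    Smr-closed-form {p} L≡p = clear-denominators (10 ^ suc k ∸ 1) {{den1-nonZero k}} {{den2-nonZero k}}
      {S = + Smr n} {N = N} {a = + (10 ^ p)} {q = Q} {Y = Y} {M = + n ℤ.- + t} (Smr-closed-form-ℤ L≡p)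

decLen-Smr-10^∸1≡ : ∀ k p →
  fromℕ p ≡ fromℕ (10 ^ k) ℚ.* (fromℕ (suc k) ℚ.- + 10 / 9) ℚ.+ fromℕ (suc k) ℚ.+ + 1 / 9 →
  decLen (Smr (10 ^ k ∸ 1)) ≡ p
decLen-Smr-10^∸1≡ k p hp = ℕ.*-cancelˡ-≡ (decLen (Smr (10 ^ k ∸ 1))) p 9
  (ℕ.+-cancelʳ-≡ (10 ℕ.* 10 ^ k) _ _ (trans (decLen-Smr-10^∸1 k) (sym (clear-ninths p (10 ^ k) (suc k) hp))))

corollary2 : (n k p : ℕ) →
    10 ^ k < n ℕ.+ 2 → n ℕ.+ 2 ≤ 10 ^ suc k →
    (+ p / 1) ≡ ((+ (10 ^ k) / 1) ℚ.* ((+ suc k / 1) ℚ.- (+ 10 / 9)) ℚ.+ (+ suc k / 1) ℚ.+ (+ 1 / 9)) →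
    (+ Smr n / 1) ≡
      ((+ Smr (10 ^ k ∸ 1 ℕ.+ 2) ℤ.- + 2 ℤ.* + (10 ^ suc k) ℤ.* + Smr (10 ^ k ∸ 1 ℕ.+ 1)
          ℤ.+ + (10 ^ (2 ℕ.* suc k)) ℤ.* + Smr (10 ^ k ∸ 1))
        / ((10 ^ suc k ∸ 1) ^ 2)) {{den2-nonZero k}}
      ℚ.+ ((+ (10 ^ p) ℤ.* (+ (10 ^ (2 ℕ.* suc k ∸ 1)) ℤ.- + (10 ^ k) ℤ.- + 1))
        / ((10 ^ suc k ∸ 1) ^ 2)) {{den2-nonZero k}}
        ℚ.* (+ (10 ^ (suc k ℕ.* (n ∸ (10 ^ k ∸ 1)))) / 1)
      ℚ.+ (+ (10 ^ p) / (10 ^ suc k ∸ 1)) {{den1-nonZero k}}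
        ℚ.* ((+ n ℤ.- + (10 ^ k ∸ 1)) / 1)
        ℚ.* (+ (10 ^ (suc k ℕ.* (n ∸ (10 ^ k ∸ 1)))) / 1)
corollary2 n k p lo hi hp = TenPowerBlock.Smr-closed-form k lo hi (decLen-Smr-10^∸1≡ k p hp)
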